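{- Let $n,k$ be integers with $2\le k\le n-1$ and let $\mathbf a=a_1a_2\cdots a_n$ be a vertex of $G(n)$. If $\mathrm{st}(a_1a_2\cdots a_{n-k})=\mathrm{st}(a_{k+1}a_{k+2}\cdots a_n)$, then there exists a closed $k$-walk in $G(n)$ starting at $\mathbf a$.
   Context: For a sequence of distinct integers $c_1\cdots c_t$, $\mathrm{st}(c_1\cdots c_t)$ is the unique permutation $b_1\cdots b_t$ of $\{1,\dots,t\}$ with $b_i<b_j$ iff $c_i<c_j$. $G(n)$ is the directed multigraph whose vertices are the permutations of $\{1,\dots,n\}$ (one-line notation) and whose edges are the permutations $c_1\cdots c_{n+1}$ of $\{1,\dots,n+1\}$, the edge $c_1\cdots c_{n+1}$ going from $\mathrm{st}(c_1\cdots c_n)$ to $\mathrm{st}(c_2\cdots c_{n+1})$; so there is an edge from $a_1\cdots a_n$ to $b_1\cdots b_n$ iff $\mathrm{st}(a_2\cdots a_n)=\mathrm{st}(b_1\cdots b_{n-1})$. A closed $k$-walk starting at $v_1$ is a sequence $(v_1,e_1,v_2,\dots,v_k,e_k,v_1)$ with $e_i$ an edge from $v_i$ to $v_{i+1}$ (indices mod $k$). -}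

module Defs where

open import Data.Nat using (ℕ; zero; suc; _<?_)
open import Data.Fin using (Fin; fromℕ; inject₁) renaming (zero to fzero; suc to fsuc)
open import Data.List using (List; map; length; filter; take; drop; upTo)
open import Data.List.Relation.Binary.Permutation.Propositional using (_↭_)
open import Data.Product using (Σ; _×_)
open import Relation.Binary.PropositionalEquality using (_≡_)

-- The standardization st(c₁⋯cₜ): the i-th entry is 1 + #{ j : c_j < c_i }.
-- For a sequence of distinct integers this is the unique permutation
-- b of {1,…,t} with b_i < b_j iff c_i < c_j.
st : List ℕ → List ℕ
st c = map (λ x → suc (length (filter (_<? x) c))) c

IsPerm : ℕ → List ℕ → Set
IsPerm n l = l ↭ map suc (upTo n)

Edge : ℕ → List ℕ → List ℕ → List ℕ → Set
Edge n c x y = IsPerm (suc n) c × st (take n c) ≡ x × st (drop 1 c) ≡ y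

-- A closed k-walk in G(n) starting at a: vertices v₁,…,v_k (here v 0 … v (k-1),
-- with v k = v 0 = a closing the cycle) and edges e₁,…,e_k with e_i from v_i to v_{i+1}.
ClosedWalk : ℕ → ℕ → List ℕ → Set
ClosedWalk n k a =
  Σ (Fin (suc k) → List ℕ) λ v →
  Σ (Fin k → List ℕ) λ e →
    v fzero ≡ a × v (fromℕ k) ≡ a
    × (∀ i → IsPerm n (v i))
    × (∀ i → Edge n (e i) (v (inject₁ i)) (v (fsuc i)))

-- It suffices to find distinct naturals w₁ ⋯ w_{n+k} whose first and last n
-- entries both standardize to a: the k+1 consecutive length-n windows of w are
-- then the vertices, and the k length-(n+1) windows the edges, of a closed
-- k-walk through a.  Such a w is a common linear extension of two orders that
-- agree on the overlap of the windows, by hypothesis.  Concretely w starts with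
-- a scaled by M = n+1, and each of the k entries u of a that only the second
-- window sees is placed just above the largest scaled overlap entry whose
-- second-window label is below u; the offset u keeps it distinct from all other
-- entries.
module Submission where

open import Defs
open import Data.Nat using (ℕ; zero; suc; _+_; _*_; _∸_; _≤_; _<_; _⊓_; _⊔_; z≤n; s≤s; s≤s⁻¹)
open import Data.Nat.Properties
open import Data.Nat.DivMod using (_%_; [m+kn]%n≡m%n; m*n%n≡0; m<n⇒m%n≡m)
open import Data.Fin using (Fin; toℕ; fromℕ; inject₁) renaming (suc to fsuc)
open import Data.Fin.Properties using (toℕ<n; toℕ-fromℕ; toℕ-inject₁)
open import Data.List using (List; []; _∷_; map; length; filter; take; drop; upTo; applyUpTo; _++_; zip)
open import Data.List.Properties using (length-map; length-upTo; length-++; length-take; length-drop; map-∘; map-cong-local; map-id; map-id-local; map-applyUpTo; map-++; take-map; drop-map; take-take; take-drop; drop-drop; take-all; take++drop≡id; filter-accept; filter-reject; filter-none; ∷-injective)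
open import Data.List.Membership.Propositional using (_∈_)
open import Data.List.Membership.Propositional.Properties using (∈-map⁻; ∈-++⁻; ∈-upTo⁻)
open import Data.List.Relation.Unary.Any using (here; there)
open import Data.List.Relation.Unary.All using (All; []; _∷_; tabulate)
import Data.List.Relation.Unary.All as All
import Data.List.Relation.Unary.All.Properties as Allₚ
open import Data.List.Relation.Unary.AllPairs using (AllPairs; []; _∷_)
import Data.List.Relation.Unary.AllPairs as AllPairs
import Data.List.Relation.Unary.AllPairs.Properties as AllPairsₚ
open import Data.List.Relation.Unary.Linked.Properties using (Linked⇒AllPairs)
open import Data.List.Relation.Unary.Unique.Propositional using (Unique)
import Data.List.Relation.Unary.Unique.Propositional.Properties as Unique
open import Data.List.Relation.Binary.Sublist.Propositional using (_⊆_; _∷ʳ_; ⊆-refl; lookup)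
open import Data.List.Relation.Binary.Sublist.Propositional.Properties using (filter⁺; length-mono-≤; take-⊆; drop-⊆)
open import Data.List.Relation.Binary.Permutation.Propositional using (_↭_; ↭-sym; ↭-trans; ↭-reflexive; ↭⇒↭ₛ)
open import Data.List.Relation.Binary.Permutation.Propositional.Properties using (∈-resp-↭; ↭-length; filter-↭)
import Data.List.Relation.Binary.Permutation.Propositional.Properties as ↭
import Data.List.Relation.Binary.Permutation.Setoid.Properties as ↭ₛ
import Data.List.Sort
open import Data.Sum using (inj₁; inj₂)
open import Data.Product using (∃-syntax; _×_; _,_; proj₁; proj₂; map₂)
open import Function using (id; _∘_; _⇔_; mk⇔; Equivalence)
open import Function.Properties.Equivalence using () renaming (sym to ⇔-sym; trans to ⇔-trans)
open import Relation.Nullary using (¬_; yes; no; contradiction)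
open import Relation.Binary.PropositionalEquality
open import Relation.Binary.Definitions using (tri<; tri≈; tri>)

open Equivalence using (to; from)

private
  variable
    f g : ℕ → ℕ
    b n k u v x y z : ℕ
    a c d w xs ys : List ℕ
    X Y Z : List (ℕ × ℕ)

<⇔<-of-mono : (∀ {x y} → x ≤ y → f x ≤ f y) → (x < y → f x < f y) → (x < y ⇔ f x < f y)
<⇔<-of-mono {f} {x} {y} mono-≤ mono-< = mk⇔ mono-< reflect
  where
  reflect : f x < f y → x < y
  reflect fx<fy with x <? y
  ... | yes x<y = x<y
  ... | no x≮y = contradiction (mono-≤ (≮⇒≥ x≮y)) (<⇒≱ fx<fy)

strictMono⇒injective : (∀ {x y} → x < y → f x < f y) → f x ≡ f y → x ≡ y
strictMono⇒injective mono-< fx≡fy =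
  ≤-antisym (≮⇒≥ λ y<x → <-irrefl (sym fx≡fy) (mono-< y<x))
            (≮⇒≥ λ x<y → <-irrefl fx≡fy (mono-< x<y))

<⇔<-of-≢ : x ≢ u → (x < u → y < v) → (u < x → v < y) → (x < u ⇔ y < v)
<⇔<-of-≢ {x} {u} {y} {v} x≢u forward backward = mk⇔ forward reflect
  where
  reflect : y < v → x < u
  reflect y<v with <-cmp x u
  ... | tri< x<u _ _ = x<u
  ... | tri≈ _ x≡u _ = contradiction x≡u x≢u
  ... | tri> _ _ u<x = contradiction (backward u<x) (<-asym y<v)

Unique-resp-↭ : xs ↭ ys → Unique xs → Unique ys
Unique-resp-↭ p = ↭ₛ.Unique-resp-↭ (setoid ℕ) (↭⇒↭ₛ p)

++-disjoint : Unique (xs ++ ys) → x ∈ xs → y ∈ ys → x ≢ y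
++-disjoint {_ ∷ xs} (x∉ ∷ _)   (here refl) y∈ = All.lookup (Allₚ.++⁻ʳ xs x∉) y∈
++-disjoint {_ ∷ _}  (_ ∷ xs!) (there x∈) y∈ = ++-disjoint xs! x∈ y∈

take-length-++ : ∀ xs → take (length xs) (xs ++ ys) ≡ xs
take-length-++ []       = refl
take-length-++ (x ∷ xs) = cong (x ∷_) (take-length-++ xs)

drop-++ : ∀ k xs → k ≤ length xs → drop k (xs ++ ys) ≡ drop k xs ++ ys
drop-++ zero    _        _         = refl
drop-++ (suc k) (_ ∷ xs) (s≤s k≤) = drop-++ k xs k≤

-- 1-based rank of x among c, so that st c is definitionally map (rank c) c.
rank : List ℕ → ℕ → ℕ
rank c x = suc (length (filter (_<? x) c))

rank-↭ : c ↭ d → rank c x ≡ rank d x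
rank-↭ {x = x} p = cong suc (↭-length (filter-↭ (_<? x) p))

rank-cons-< : ∀ c → z < x → rank (z ∷ c) x ≡ suc (rank c x)
rank-cons-< {x = x} _ z<x = cong (suc ∘ length) (filter-accept (_<? x) z<x)

rank-cons-≮ : ∀ c → ¬ z < x → rank (z ∷ c) x ≡ rank c x
rank-cons-≮ {x = x} _ z≮x = cong (suc ∘ length) (filter-reject (_<? x) z≮x)

rank-mono : c ⊆ d → x ≤ y → rank c x ≤ rank d y
rank-mono {x = x} {y} c⊆d x≤y =
  s≤s (length-mono-≤ (filter⁺ (_<? x) (_<? y) (λ { refl z<x → <-≤-trans z<x x≤y }) c⊆d))

rank-mono-≤ : ∀ c → x ≤ y → rank c x ≤ rank c y
rank-mono-≤ c = rank-mono (⊆-refl {x = c})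

rank-mono-< : x ∈ c → x < y → rank c x < rank c y
rank-mono-< {c = z ∷ c} {y = y} (here refl) z<y = begin-strict
  rank (z ∷ c) z ≡⟨ rank-cons-≮ c (n≮n z) ⟩
  rank c z       ≤⟨ rank-mono-≤ c (<⇒≤ z<y) ⟩
  rank c y       <⟨ n<1+n _ ⟩
  suc (rank c y) ≡⟨ rank-cons-< c z<y ⟨
  rank (z ∷ c) y ∎
  where open ≤-Reasoning
rank-mono-< {x} {z ∷ c} {y} (there x∈c) x<y with z <? x
... | yes z<x = begin-strict
  rank (z ∷ c) x ≡⟨ rank-cons-< c z<x ⟩
  suc (rank c x) <⟨ s≤s (rank-mono-< x∈c x<y) ⟩
  suc (rank c y) ≡⟨ rank-cons-< c (<-trans z<x x<y) ⟨
  rank (z ∷ c) y ∎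
  where open ≤-Reasoning
... | no z≮x = begin-strict
  rank (z ∷ c) x ≡⟨ rank-cons-≮ c z≮x ⟩
  rank c x       <⟨ rank-mono-< x∈c x<y ⟩
  rank c y       ≤⟨ rank-mono (z ∷ʳ ⊆-refl {x = c}) ≤-refl ⟩
  rank (z ∷ c) y ∎
  where open ≤-Reasoning

rank-<⇔ : x ∈ c → (x < y ⇔ rank c x < rank c y)
rank-<⇔ {c = c} x∈c = <⇔<-of-mono (rank-mono-≤ c) (rank-mono-< x∈c)

SameOrder : ℕ × ℕ → ℕ × ℕ → Set
SameOrder p q = proj₁ p < proj₁ q ⇔ proj₂ p < proj₂ q

OrderIsomorphic : List (ℕ × ℕ) → Set
OrderIsomorphic Z = ∀ {p q} → p ∈ Z → q ∈ Z → SameOrder p q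

graph : (ℕ → ℕ) → List ℕ → List (ℕ × ℕ)
graph f d = map (λ x → x , f x) d

rank-proj : ∀ Y q → All (λ p → SameOrder p q) Y →
            rank (map proj₁ Y) (proj₁ q) ≡ rank (map proj₂ Y) (proj₂ q)
rank-proj []      q []          = refl
rank-proj (p ∷ Y) q (p~q ∷ Y~q) with proj₁ p <? proj₁ q
... | yes p₁<q₁ = trans (rank-cons-< _ p₁<q₁)
                    (trans (cong suc (rank-proj Y q Y~q)) (sym (rank-cons-< _ (to p~q p₁<q₁))))
... | no p₁≮q₁  = trans (rank-cons-≮ _ p₁≮q₁)
                    (trans (rank-proj Y q Y~q) (sym (rank-cons-≮ _ (p₁≮q₁ ∘ from p~q))))

st-orderIso : OrderIsomorphic Z → st (map proj₁ Z) ≡ st (map proj₂ Z)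
st-orderIso {Z} iso = begin
  map (rank (map proj₁ Z)) (map proj₁ Z) ≡⟨ map-∘ Z ⟨
  map (rank (map proj₁ Z) ∘ proj₁) Z     ≡⟨ map-cong-local (tabulate λ q∈ →
                                              rank-proj Z _ (tabulate λ p∈ → iso p∈ q∈)) ⟩
  map (rank (map proj₂ Z) ∘ proj₂) Z     ≡⟨ map-∘ Z ⟩
  map (rank (map proj₂ Z)) (map proj₂ Z) ∎
  where open ≡-Reasoning

orderIso-graph : (∀ {x y} → x ∈ d → y ∈ d → (x < y ⇔ f x < f y)) → OrderIsomorphic (graph f d)
orderIso-graph {f = f} emb p∈ q∈ with ∈-map⁻ (λ x → x , f x) p∈ | ∈-map⁻ (λ x → x , f x) q∈
... | _ , x∈ , refl | _ , y∈ , refl = emb x∈ y∈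

st-map : (∀ {x y} → x ∈ d → y ∈ d → (x < y ⇔ f x < f y)) → st (map f d) ≡ st d
st-map {d} {f} emb = begin
  st (map f d)               ≡⟨ cong st (map-∘ d) ⟩
  st (map proj₂ (graph f d)) ≡⟨ st-orderIso (orderIso-graph emb) ⟨
  st (map proj₁ (graph f d)) ≡⟨ cong st (trans (sym (map-∘ d)) (map-id d)) ⟩
  st d                       ∎
  where open ≡-Reasoning

st-map-rank : d ⊆ c → st (map (rank c) d) ≡ st d
st-map-rank d⊆c = st-map (λ x∈d _ → rank-<⇔ (lookup d⊆c x∈d))

st-take-st : ∀ m c → st (take m (st c)) ≡ st (take m c)
st-take-st m c = trans (cong st (take-map m c)) (st-map-rank (take-⊆ m c))

st-drop-st : ∀ m c → st (drop m (st c)) ≡ st (drop m c)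
st-drop-st m c = trans (cong st (drop-map m c)) (st-map-rank (drop-⊆ m c))

∈-zip⁻ : (x , y) ∈ zip xs ys → x ∈ xs × y ∈ ys
∈-zip⁻ {xs = _ ∷ _} {_ ∷ _} (here refl) = here refl , here refl
∈-zip⁻ {xs = _ ∷ _} {_ ∷ _} (there p∈) with ∈-zip⁻ p∈
... | x∈ , y∈ = there x∈ , there y∈

map-≡-∈-zip : map f xs ≡ map g ys → (x , y) ∈ zip xs ys → f x ≡ g y
map-≡-∈-zip {xs = _ ∷ _} {ys = _ ∷ _} eq (here refl) = proj₁ (∷-injective eq)
map-≡-∈-zip {xs = _ ∷ _} {ys = _ ∷ _} eq (there p∈) = map-≡-∈-zip (proj₂ (∷-injective eq)) p∈

map-proj₁-zip : length xs ≡ length ys → map proj₁ (zip xs ys) ≡ xs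
map-proj₁-zip {[]}     {[]}     _   = refl
map-proj₁-zip {x ∷ xs} {_ ∷ ys} len = cong (x ∷_) (map-proj₁-zip (suc-injective len))

map-proj₂-zip : length xs ≡ length ys → map proj₂ (zip xs ys) ≡ ys
map-proj₂-zip {[]}     {[]}     _   = refl
map-proj₂-zip {_ ∷ xs} {y ∷ ys} len = cong (y ∷_) (map-proj₂-zip (suc-injective len))

orderIso-st : st xs ≡ st ys → OrderIsomorphic (zip xs ys)
orderIso-st {xs} {ys} eq {x , y} {x′ , y′} p∈ q∈ with ∈-zip⁻ p∈ | ∈-zip⁻ q∈
... | x∈ , y∈ | _ , _ =
  ⇔-trans (subst₂ (λ r r′ → x < x′ ⇔ r < r′) (map-≡-∈-zip eq p∈) (map-≡-∈-zip eq q∈) (rank-<⇔ x∈))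
          (⇔-sym (rank-<⇔ y∈))

orderIso-++ : OrderIsomorphic X → OrderIsomorphic Y →
              (∀ {p q} → p ∈ X → q ∈ Y → SameOrder p q × SameOrder q p) →
              OrderIsomorphic (X ++ Y)
orderIso-++ {X} isoX isoY cross p∈ q∈ with ∈-++⁻ X p∈ | ∈-++⁻ X q∈
... | inj₁ p∈X | inj₁ q∈X = isoX p∈X q∈X
... | inj₂ p∈Y | inj₂ q∈Y = isoY p∈Y q∈Y
... | inj₁ p∈X | inj₂ q∈Y = proj₁ (cross p∈X q∈Y)
... | inj₂ p∈Y | inj₁ q∈X = proj₂ (cross q∈X p∈Y)

orderIso-map₂ : (∀ {x y} → x < y ⇔ g x < g y) → OrderIsomorphic Z → OrderIsomorphic (map (map₂ g) Z)
orderIso-map₂ {g} emb iso p∈ q∈ with ∈-map⁻ (map₂ g) p∈ | ∈-map⁻ (map₂ g) q∈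
... | _ , p∈Z , refl | _ , q∈Z , refl = ⇔-trans (iso p∈Z q∈Z) emb

st-↭ : c ↭ d → st c ↭ st d
st-↭ {d = d} p = ↭-trans (↭-reflexive (map-cong-local (tabulate λ _ → rank-↭ p))) (↭.map⁺ (rank d) p)

st-ascending : AllPairs _<_ c → st c ≡ map suc (upTo (length c))
st-ascending {[]}    []          = refl
st-ascending {x ∷ c} (x<c ∷ asc) = cong₂ _∷_ rank-head (begin
  map (rank (x ∷ c)) c                ≡⟨ map-cong-local (All.map (rank-cons-< c) x<c) ⟩
  map (suc ∘ rank c) c                ≡⟨ map-∘ c ⟩
  map suc (st c)                      ≡⟨ cong (map suc) (st-ascending asc) ⟩
  map suc (map suc (upTo (length c))) ≡⟨ cong (map suc) (map-applyUpTo id suc (length c)) ⟩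
  map suc (applyUpTo suc (length c))  ∎)
  where
  open ≡-Reasoning
  rank-head : rank (x ∷ c) x ≡ 1
  rank-head = trans (rank-cons-≮ c (n≮n x))
                    (cong (suc ∘ length) (filter-none (_<? x) (All.map <-asym x<c)))

open Data.List.Sort ≤-decTotalOrder using (sort; sort-↭; sort-↗)

st-isPerm : Unique w → IsPerm (length w) (st w)
st-isPerm {w} uw = ↭-trans (st-↭ (↭-sym (sort-↭ w)))
  (↭-reflexive (trans (st-ascending ascending) (cong (map suc ∘ upTo) (↭-length (sort-↭ w)))))
  where
  ascending : AllPairs _<_ (sort w)
  ascending = AllPairs.zipWith (λ (x≤y , x≢y) → ≤∧≢⇒< x≤y x≢y)
    (Linked⇒AllPairs ≤-trans (sort-↗ w) , Unique-resp-↭ (↭-sym (sort-↭ w)) uw)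

st-oneTo : ∀ n → st (map suc (upTo n)) ≡ map suc (upTo n)
st-oneTo n = trans (st-ascending (AllPairsₚ.map⁺ (AllPairsₚ.applyUpTo⁺₁ id n λ i<j _ → s≤s i<j)))
                   (cong (map suc ∘ upTo) (trans (length-map suc (upTo n)) (length-upTo n)))

map-≡-∈ : map f c ≡ c → x ∈ c → f x ≡ x
map-≡-∈ {c = _ ∷ _} eq (here refl) = proj₁ (∷-injective eq)
map-≡-∈ {c = _ ∷ _} eq (there x∈) = map-≡-∈ (proj₂ (∷-injective eq)) x∈

st-of-isPerm : IsPerm n a → st a ≡ a
st-of-isPerm {n} pa = map-id-local (tabulate λ x∈a →
  trans (rank-↭ pa) (map-≡-∈ (st-oneTo n) (∈-resp-↭ pa x∈a)))

isPerm-unique : IsPerm n a → Unique a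
isPerm-unique {n} pa = Unique-resp-↭ (↭-sym pa) (Unique.map⁺ suc-injective (Unique.upTo⁺ n))

isPerm-length : IsPerm n a → length a ≡ n
isPerm-length {n} pa = trans (↭-length pa) (trans (length-map suc (upTo n)) (length-upTo n))

isPerm-∈ : IsPerm n a → x ∈ a → 0 < x × x ≤ n
isPerm-∈ pa x∈a with ∈-map⁻ suc (∈-resp-↭ pa x∈a)
... | _ , i∈ , refl = s≤s z≤n , ∈-upTo⁻ i∈

ClosingWord : ℕ → ℕ → List ℕ → List ℕ → Set
ClosingWord n k a w = Unique w × length w ≡ n + k × st (take n w) ≡ a × st (drop k w) ≡ a

closedWalk-of-closingWord : ClosingWord n k a w → ClosedWalk n k a
closedWalk-of-closingWord {n} {k} {a} {w} (uw , len , first , last) =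
  vertex , edge , first , closes , (λ j → window-isPerm n (vertex-fits j)) , isEdge
  where
  open ≡-Reasoning

  window : ℕ → ℕ → List ℕ
  window m j = take m (drop j w)

  length-drop-w : ∀ j → length (drop j w) ≡ (n + k) ∸ j
  length-drop-w j = trans (length-drop j w) (cong (_∸ j) len)

  window-isPerm : ∀ m {j} → m + j ≤ n + k → IsPerm m (st (window m j))
  window-isPerm m {j} fits =
    subst (λ l → IsPerm l (st (window m j))) length-window
          (st-isPerm (Unique.take⁺ m (Unique.drop⁺ j uw)))
    where
    length-window : length (window m j) ≡ m
    length-window = trans (length-take m (drop j w))
      (m≤n⇒m⊓n≡m (subst (m ≤_) (sym (length-drop-w j)) (m+n≤o⇒m≤o∸n m fits)))

  vertex : Fin (suc k) → List ℕ
  vertex j = st (window n (toℕ j))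

  edge : Fin k → List ℕ
  edge i = st (window (suc n) (toℕ i))

  vertex-fits : ∀ j → n + toℕ j ≤ n + k
  vertex-fits j = +-monoʳ-≤ n (s≤s⁻¹ (toℕ<n j))

  closes : vertex (fromℕ k) ≡ a
  closes = begin
    st (window n (toℕ (fromℕ k))) ≡⟨ cong (st ∘ window n) (toℕ-fromℕ k) ⟩
    st (take n (drop k w))        ≡⟨ cong st (take-all n (drop k w)
                                       (≤-reflexive (trans (length-drop-w k) (m+n∸n≡m n k)))) ⟩
    st (drop k w)                 ≡⟨ last ⟩
    a                             ∎

  isEdge : ∀ i → Edge n (edge i) (vertex (inject₁ i)) (vertex (fsuc i))
  isEdge i = window-isPerm (suc n) edge-fits , to-source , to-target
    where
    edge-fits : suc n + toℕ i ≤ n + k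
    edge-fits = subst (_≤ n + k) (+-suc n (toℕ i)) (+-monoʳ-≤ n (toℕ<n i))

    to-source : st (take n (edge i)) ≡ vertex (inject₁ i)
    to-source = begin
      st (take n (edge i))                  ≡⟨ st-take-st n (window (suc n) (toℕ i)) ⟩
      st (take n (window (suc n) (toℕ i)))  ≡⟨ cong st (take-take n (suc n) _) ⟩
      st (take (n ⊓ suc n) (drop (toℕ i) w)) ≡⟨ cong (λ m → st (take m (drop (toℕ i) w))) (m≤n⇒m⊓n≡m (n≤1+n n)) ⟩
      st (window n (toℕ i))                 ≡⟨ cong (st ∘ window n) (toℕ-inject₁ i) ⟨
      vertex (inject₁ i)                    ∎

    to-target : st (drop 1 (edge i)) ≡ vertex (fsuc i)
    to-target = begin
      st (drop 1 (edge i))                  ≡⟨ st-drop-st 1 (window (suc n) (toℕ i)) ⟩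
      st (drop 1 (window (suc n) (toℕ i)))  ≡⟨ cong st (take-drop n 1 (drop (toℕ i) w)) ⟨
      st (take n (drop 1 (drop (toℕ i) w))) ≡⟨ cong (st ∘ take n) (drop-drop (toℕ i) 1 w) ⟩
      st (window n (toℕ i + 1))             ≡⟨ cong (st ∘ window n) (+-comm (toℕ i) 1) ⟩
      vertex (fsuc i)                       ∎

maxBelow : List (ℕ × ℕ) → ℕ → ℕ
maxBelow []            u = 0
maxBelow ((x , y) ∷ Z) u with x <? u
... | yes _ = y ⊔ maxBelow Z u
... | no _  = maxBelow Z u

≤-maxBelow : (x , y) ∈ Z → x < u → y ≤ maxBelow Z u
≤-maxBelow {Z = (x′ , y′) ∷ Z} {u = u} p∈ x<u with x′ <? u | p∈
... | yes _   | here refl = m≤m⊔n y′ _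
... | yes _   | there p∈Z = ≤-trans (≤-maxBelow p∈Z x<u) (m≤n⊔m y′ _)
... | no x′≮u | here refl = contradiction x<u x′≮u
... | no _    | there p∈Z = ≤-maxBelow p∈Z x<u

maxBelow-< : (∀ {x y} → (x , y) ∈ Z → x < u → y < b) → 0 < b → maxBelow Z u < b
maxBelow-< {[]}            _     0<b = 0<b
maxBelow-< {(x , y) ∷ Z} {u} below 0<b with x <? u
... | yes x<u = ⊔-lub (below (here refl) x<u) (maxBelow-< (λ p∈ → below (there p∈)) 0<b)
... | no _    = maxBelow-< (λ p∈ → below (there p∈)) 0<b

maxBelow-mono : ∀ Z → u ≤ v → maxBelow Z u ≤ maxBelow Z v
maxBelow-mono []                _ = z≤n
maxBelow-mono {u} {v} ((x , y) ∷ Z) u≤v with x <? u | x <? v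
... | yes _   | yes _  = ⊔-monoʳ-≤ y (maxBelow-mono Z u≤v)
... | yes x<u | no x≮v = contradiction (<-≤-trans x<u u≤v) x≮v
... | no _    | yes _  = ≤-trans (maxBelow-mono Z u≤v) (m≤n⊔m y _)
... | no _    | no _   = maxBelow-mono Z u≤v

module _ {n k a} (k≤n : k ≤ n) (pa : IsPerm n a) (st-overlap : st (take (n ∸ k) a) ≡ st (drop k a)) where

  private
    M : ℕ
    M = suc n

    front back rest : List ℕ
    front = take (n ∸ k) a
    back  = drop k a
    rest  = drop (n ∸ k) a

    -- (a_i , a_{k+i}): the labels of position k+i in the second and in the first window.
    overlapPairs : List (ℕ × ℕ)
    overlapPairs = zip front back

    lift : ℕ → ℕ
    lift u = u + maxBelow overlapPairs u * M

    word : List ℕ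
    word = map (_* M) a ++ map lift rest

    length-a : length a ≡ n
    length-a = isPerm-length pa

    length-front≡back : length front ≡ length back
    length-front≡back = begin
      length front      ≡⟨ length-take (n ∸ k) a ⟩
      (n ∸ k) ⊓ length a ≡⟨ cong ((n ∸ k) ⊓_) length-a ⟩
      (n ∸ k) ⊓ n        ≡⟨ m≤n⇒m⊓n≡m (m∸n≤m n k) ⟩
      n ∸ k              ≡⟨ cong (_∸ k) length-a ⟨
      length a ∸ k       ≡⟨ length-drop k a ⟨
      length back       ∎
      where open ≡-Reasoning

    length-rest : length rest ≡ k
    length-rest = trans (length-drop (n ∸ k) a) (trans (cong (_∸ (n ∸ k)) length-a) (m∸[m∸n]≡n k≤n))

    rest-bounds : u ∈ rest → 0 < u × u < M
    rest-bounds u∈ with isPerm-∈ pa (lookup (drop-⊆ (n ∸ k) a) u∈)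
    ... | 0<u , u≤n = 0<u , s≤s u≤n

    back-positive : y ∈ back → 0 < y
    back-positive y∈ = proj₁ (isPerm-∈ pa (lookup (drop-⊆ k a) y∈))

    front-rest-disjoint : x ∈ front → u ∈ rest → x ≢ u
    front-rest-disjoint =
      ++-disjoint (subst Unique (sym (take++drop≡id (n ∸ k) a)) (isPerm-unique pa))

    overlap-orderIso : OrderIsomorphic overlapPairs
    overlap-orderIso = orderIso-st st-overlap

    scale-<⇔ : x < y ⇔ x * M < y * M
    scale-<⇔ = <⇔<-of-mono (*-monoˡ-≤ M) (*-monoˡ-< M)

    lift-<⇔ : u < v ⇔ lift u < lift v
    lift-<⇔ = <⇔<-of-mono
      (λ u≤v → +-mono-≤ u≤v (*-monoˡ-≤ M (maxBelow-mono overlapPairs u≤v)))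
      (λ u<v → +-mono-<-≤ u<v (*-monoˡ-≤ M (maxBelow-mono overlapPairs (<⇒≤ u<v))))

    lift-mod : u < M → lift u % M ≡ u
    lift-mod {u} u<M = trans ([m+kn]%n≡m%n u (maxBelow overlapPairs u) M) (m<n⇒m%n≡m u<M)

    cross : (x , y) ∈ overlapPairs → u ∈ rest →
            (x < u ⇔ y * M < lift u) × (u < x ⇔ lift u < y * M)
    cross {x} {y} {u} p∈ u∈ =
      <⇔<-of-≢ x≢u below above , <⇔<-of-≢ (x≢u ∘ sym) above below
      where
      x≢u : x ≢ u
      x≢u = front-rest-disjoint (proj₁ (∈-zip⁻ p∈)) u∈

      below : x < u → y * M < lift u
      below x<u = ≤-<-trans (*-monoˡ-≤ M (≤-maxBelow p∈ x<u)) (m<n+m _ (proj₁ (rest-bounds u∈)))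

      above : u < x → lift u < y * M
      above u<x = <-≤-trans (+-monoˡ-< _ (proj₂ (rest-bounds u∈))) (*-monoˡ-≤ M
        (maxBelow-< (λ q∈ x′<u → to (overlap-orderIso q∈ p∈) (<-trans x′<u u<x))
                    (back-positive (proj₂ (∈-zip⁻ p∈)))))

    pairs : List (ℕ × ℕ)
    pairs = map (map₂ (_* M)) overlapPairs ++ graph lift rest

    pairs-orderIso : OrderIsomorphic pairs
    pairs-orderIso = orderIso-++ (orderIso-map₂ scale-<⇔ overlap-orderIso)
                                 (orderIso-graph λ _ _ → lift-<⇔) cross′
      where
      cross′ : ∀ {p q} → p ∈ map (map₂ (_* M)) overlapPairs → q ∈ graph lift rest →
               SameOrder p q × SameOrder q p
      cross′ p∈ q∈ with ∈-map⁻ (map₂ (_* M)) p∈ | ∈-map⁻ (λ u → u , lift u) q∈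
      ... | _ , r∈ , refl | _ , u∈ , refl = cross r∈ u∈

    map-proj₁-pairs : map proj₁ pairs ≡ a
    map-proj₁-pairs = begin
      map proj₁ pairs
        ≡⟨ map-++ proj₁ (map (map₂ (_* M)) overlapPairs) (graph lift rest) ⟩
      map proj₁ (map (map₂ (_* M)) overlapPairs) ++ map proj₁ (graph lift rest)
        ≡⟨ cong₂ _++_ (trans (sym (map-∘ overlapPairs)) (map-proj₁-zip length-front≡back))
                      (trans (sym (map-∘ rest)) (map-id rest)) ⟩
      front ++ rest
        ≡⟨ take++drop≡id (n ∸ k) a ⟩
      a ∎
      where open ≡-Reasoning

    map-proj₂-pairs : map proj₂ pairs ≡ drop k word
    map-proj₂-pairs = begin
      map proj₂ pairs
        ≡⟨ map-++ proj₂ (map (map₂ (_* M)) overlapPairs) (graph lift rest) ⟩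
      map proj₂ (map (map₂ (_* M)) overlapPairs) ++ map proj₂ (graph lift rest)
        ≡⟨ cong₂ _++_ (trans (sym (map-∘ overlapPairs))
                             (trans (map-∘ overlapPairs) (cong (map (_* M)) (map-proj₂-zip length-front≡back))))
                      (sym (map-∘ rest)) ⟩
      map (_* M) back ++ map lift rest
        ≡⟨ cong (_++ map lift rest) (drop-map k a) ⟨
      drop k (map (_* M) a) ++ map lift rest
        ≡⟨ drop-++ k (map (_* M) a) (subst (k ≤_) (sym (trans (length-map (_* M) a) length-a)) k≤n) ⟨
      drop k word ∎
      where open ≡-Reasoning

    take-word : take n word ≡ map (_* M) a
    take-word = subst (λ m → take m word ≡ map (_* M) a) (trans (length-map (_* M) a) length-a)
                      (take-length-++ (map (_* M) a))

    length-word : length word ≡ n + k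
    length-word = trans (length-++ (map (_* M) a))
      (cong₂ _+_ (trans (length-map (_* M) a) length-a) (trans (length-map lift rest) length-rest))

    -- Entries of the second block are ≡ u ≢ 0 modulo M, those of the first are ≡ 0.
    word-unique : Unique word
    word-unique = Unique.++⁺ (Unique.map⁺ (*-cancelʳ-≡ _ _ M) (isPerm-unique pa))
      (Unique.map⁺ (strictMono⇒injective (to lift-<⇔)) (Unique.drop⁺ (n ∸ k) (isPerm-unique pa)))
      disjoint
      where
      disjoint : ∀ {v} → ¬ (v ∈ map (_* M) a × v ∈ map lift rest)
      disjoint (v∈ , v∈′) with ∈-map⁻ (_* M) v∈ | ∈-map⁻ lift v∈′
      ... | x , _ , refl | u , u∈ , x*M≡lift-u with rest-bounds u∈
      ... | 0<u , u<M = <-irrefl (sym u≡0) 0<u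
        where
        u≡0 : u ≡ 0
        u≡0 = trans (sym (lift-mod u<M)) (trans (cong (_% M) (sym x*M≡lift-u)) (m*n%n≡0 x M))

  closingWord : ∃[ w ] ClosingWord n k a w
  closingWord = word , word-unique , length-word , first-window , second-window
    where
    first-window : st (take n word) ≡ a
    first-window = trans (cong st take-word) (trans (st-map (λ _ _ → scale-<⇔)) (st-of-isPerm pa))

    second-window : st (drop k word) ≡ a
    second-window = begin
      st (drop k word)     ≡⟨ cong st map-proj₂-pairs ⟨
      st (map proj₂ pairs) ≡⟨ st-orderIso pairs-orderIso ⟨
      st (map proj₁ pairs) ≡⟨ cong st map-proj₁-pairs ⟩
      st a                 ≡⟨ st-of-isPerm pa ⟩
      a                    ∎
      where open ≡-Reasoning

theorem3p3 : (n k : ℕ) → 2 ≤ k → k < n → (a : List ℕ) → IsPerm n a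
    → st (take (n ∸ k) a) ≡ st (drop k a) → ClosedWalk n k a
theorem3p3 n k _ k<n a pa st-overlap =
  closedWalk-of-closingWord (proj₂ (closingWord (<⇒≤ k<n) pa st-overlap))
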